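{- Let $x\in\mathcal{V}$, let $\mathcal{T}$ be an a-solvable single-path loop as described in the context such that the recurrence system $\mathsf{Rec}$ can be solved, and let $x[\vec r_1],\ldots,x[\vec r_k]$ be all elements of $\vec\ell$ whose array variable is $x$. If $\mathsf{up}(\vec r_i)-\vec r_i$ is a vector of integer constants for every $i\in[1,k]$, then \[ x^{(n)} := \lambda\vec c.\ \mathbf{if}\ 1\le e_{x[\vec r_1]}\le n\wedge\mathsf{last\_write}_{x[\vec r_1]}(e_{x[\vec r_1]},n,\vec c)\ \mathbf{then}\ \mathsf{rhs}(x[\vec r_1])^{(e_{x[\vec r_1]}-1)}\ \mathbf{else}\ \cdots\ \mathbf{else\ if}\ 1\le e_{x[\vec r_k]}\le n\wedge\mathsf{last\_write}_{x[\vec r_k]}(e_{x[\vec r_k]},n,\vec c)\ \mathbf{then}\ \mathsf{rhs}(x[\vec r_k])^{(e_{x[\vec r_k]}-1)}\ \mathbf{else}\ x[\vec c] \] is a closed form for $x$, i.e., $x^{(n)}=\mathsf{up}^n(x)$ holds for all $n\in\mathbb{N}$.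
   Context: Variables and arrays: $\mathcal{V}$ is a countably infinite set of variables, each with an arity; $x$ denotes a function $\mathbb{Z}^{\mathsf{arity}(x)}\to\mathbb{Z}$ (arity $0$ = scalar; $i[\,]$ written $i$). Rvalues: $r::=c\mid r\circ r\mid x[r_1,\ldots,r_k]$ ($c\in\mathbb{Z}$, $\circ$ arithmetic operator among $+,-,\cdot$, integer division $\div$). An lvalue is an rvalue of the form $x[\vec r]$. $\mathit{Lval}(r)$ = top-level lvalues of $r$: $\{r\}$ if $r$ is an lvalue, $\mathit{Lval}(r_1)\cup\mathit{Lval}(r_2)$ if $r=r_1\circ r_2$, $\emptyset$ for integers; unions for vectors. Expressions may contain if-then-else and $\lambda$-array expressions $\lambda\vec c.\,e$ (denoting functions); an equation holds/is valid if true in every state, arrays being compared as functions. Loop $\mathcal{T}$: $\mathbf{while}\ \phi\ \mathbf{do}\ (\ell_1,\ldots,\ell_m)\leftarrow(r_1,\ldots,r_m)$, $\phi$ a conjunction of (in)equations over rvalues, $\ell_j=x_j[\vec r_j]$ lvalues with $x_i\ne x_j$ or $\vec r_i\ne\vec r_j$ for $i\ne j$, simultaneous update; $\vec\ell=(\ell_1,\ldots,\ell_m)$, $\mathsf{rhs}(x_j[\vec r_j]):=r_j$. Update: $\mathsf{up}_x(\text{empty})=x$; $\mathsf{up}_x(x[\vec r],\vec\ell')=\lambda\vec i.\ \mathbf{if}\ \vec i=\vec r\ \mathbf{then}\ \mathsf{rhs}(x[\vec r])\ \mathbf{else}\ \mathsf{up}_x(\vec\ell')[\vec i]$ ($\vec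 i$ fresh); $\mathsf{up}_x(y[\vec r],\vec\ell')=\mathsf{up}_x(\vec\ell')$ for $y\ne x$. $\mathsf{up}=[x/\mathsf{up}_x(\vec\ell)\mid x\in\mathcal{V}]$ (componentwise on vectors); $\mathsf{up}^n$ its $n$-fold iteration. Monotonicity and a-solvability: vectors compared lexicographically (empty vectors equal); following the paper's convention that monotonic loops are increasing, $\mathcal{T}$ is monotonic if for every $x$, $\bigwedge_{x[\vec r]\in\vec\ell}\vec r\le\mathsf{up}(\vec r)$ is valid. $\mathcal{L}$ is the smallest set with $\mathit{Lval}(r_j)\subseteq\mathcal{L}$ for all $j$ and $x[\vec r]\in\mathcal{L}\Rightarrow\mathit{Lval}(\vec r)\subseteq\mathcal{L}$. For $x[\vec r]\in\mathcal{L}$: trivial if no $y$ with $y[\vec r']\in\vec\ell$ occurs in $x[\vec r]$; inductive if $x[\mathsf{up}(\vec r)]\in\vec\ell$; displacing if $\vec r'<\mathsf{up}(\vec r)$ is valid whenever $x[\vec r']\in\vec\ell$. $\mathcal{T}$ is a-solvable if monotonic, each element of $\mathcal{L}$ is trivial, inductive or displacing, and for each $j$ all lvalues of $\mathit{Lval}(r_j)$ are trivial or inductive, or all are displacing. Recurrences: $\sigma_{\mathsf{rec}}$ replaces each top-level lvalue $\ell$ by a fresh symbol $\mathsf{rec}_\ell$; $\mathsf{Rec}$ consists of the equations $\mathsf{rec}'_{x[\vec r]}=\mathsf{rhs}(x[\mathsf{up}(\vec r)])\sigma_{\mathsf{rec}}$ for each inductive $x[\vec r]\in\mathcal{L}$;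 a solution is a substitution $\theta$ into arithmetic expressions over the symbols and a fresh variable $n$ with $\theta(\mathsf{rec})[n/n+1]=\theta(e)$ and $\theta(\mathsf{rec})[n/0]=\mathsf{rec}$ valid for each equation $\mathsf{rec}'=e$. Closed forms: an expression $y^{(n)}$ over $\mathcal{V}\cup\{n\}$ is a closed form for a variable or lvalue $y$ if $y^{(n)}=\mathsf{up}^n(y)$ holds for all $n\in\mathbb{N}$. A closed form $\ell^{(n)}$ is fixed for every lvalue occurring at top level in the index vectors or right-hand sides of the loop; for such an rvalue or vector $e$, $e^{(n)}:=e[\ell/\ell^{(n)}\mid\ell\in\mathit{Lval}(e)]$ and $e^{(k)}:=e^{(n)}[n/k]$. Predicates: for $x[\vec r]\in\vec\ell$: $\mathsf{written}_{\vec r}(m,\vec c)\iff\vec r^{(m-1)}=\vec c$; $\mathsf{notwritten}_x(m,n,\vec c)\iff\bigwedge_{x[\vec r]\in\vec\ell}\forall m'\in[m,n].\ \neg\mathsf{written}_{\vec r}(m',\vec c)$; $\mathsf{last\_write}_{x[\vec r]}(m,n,\vec c)\iff\mathsf{written}_{\vec r}(m,\vec c)\wedge\mathsf{notwritten}_x(m+1,n,\vec c)$. Instantiation $e_{x[\vec r]}$: for $x[\vec r]\in\vec\ell$ with $\vec d:=\mathsf{up}(\vec r)-\vec r$ a constant vector, if some $d_i\neq0$ then (for a fixed such $i$) $e_{x[\vec r]}:=(c_i-r_i)\div d_i+1$, and if $\vec d$ is the zero vector then $e_{x[\vec r]}:=n$. (This is the expression such that $\forall m\in[1,n].\ \mathsf{last\_write}_{x[\vec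 r]}(m,n,\vec c)\Rightarrow\mathsf{up}^n(x)[\vec c]=\mathsf{rhs}(x[\vec r])^{(m-1)}$ is equivalent to its instance at $m=e_{x[\vec r]}$ guarded by $1\le e_{x[\vec r]}\le n$.) -}

module Defs where

open import Data.Nat as ℕ using (ℕ; zero; suc; _≡ᵇ_)
open import Data.Integer as ℤ using (ℤ; +_; -[1+_]; _+_; _-_; _*_; ∣_∣)
import Data.Integer.Properties as ℤP
open import Data.Bool using (Bool; true; false; if_then_else_; _∧_; _∨_; not)
open import Data.List as List using (List; []; _∷_; _++_; concatMap; map; upTo)
open import Data.Bool.ListAction using (and)
import Data.List.Properties as ListP
open import Data.List.Membership.Propositional using (_∈_; _∉_)
open import Data.List.Relation.Unary.Unique.Propositional using (Unique)
open import Data.Vec as Vec using (Vec; []; _∷_; toList; zipWith)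
open import Data.Fin using (Fin; zero; suc)
open import Data.Maybe using (Maybe; just; nothing)
open import Data.Product using (Σ; _×_; _,_; ∃)
open import Data.Sum using (_⊎_)
open import Relation.Binary.PropositionalEquality using (_≡_; refl; subst; sym)
open import Relation.Binary.Definitions using (DecidableEquality)
open import Relation.Nullary using (¬_; does; yes; no)
open import Function using (_∘_)

record Var : Set where
  constructor var
  field
    name  : ℕ
    arity : ℕ
open Var public

_≟V_ : DecidableEquality Var
var a b ≟V var a' b' with a ℕ.≟ a' | b ℕ.≟ b'
... | yes refl | yes refl = yes refl
... | no p     | _        = no (λ { refl → p refl })
... | yes _    | no q     = no (λ { refl → q refl })

_==V_ : Var → Var → Bool
x ==V y = does (x ≟V y)

State : Set
State = (x : Var) → Vec ℤ (arity x) → ℤ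

-- Integer arithmetic.  Integer division ÷ : Euclidean division of the
-- standard library; division by 0 is (arbitrarily) 0.

_÷_ : ℤ → ℤ → ℤ
i ÷ (+ zero)    = + 0
i ÷ j@(+ suc _) = i ℤ./ j
i ÷ j@(-[1+ _ ]) = i ℤ./ j

data Op : Set where
  plus minus times divide : Op

⟦_⟧op : Op → ℤ → ℤ → ℤ
⟦ plus ⟧op   = _+_
⟦ minus ⟧op  = _-_
⟦ times ⟧op  = _*_
⟦ divide ⟧op = _÷_

data RVal : Set where
  const : ℤ → RVal
  op    : Op → RVal → RVal → RVal
  acc   : (x : Var) → Vec RVal (arity x) → RVal

mutual
  evalR : State → RVal → ℤ
  evalR σ (const c)  = c
  evalR σ (op o a b) = ⟦ o ⟧op (evalR σ a) (evalR σ b)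
  evalR σ (acc x rs) = σ x (evalRs σ rs)

  evalRs : ∀ {k} → State → Vec RVal k → Vec ℤ k
  evalRs σ []       = []
  evalRs σ (r ∷ rs) = evalR σ r ∷ evalRs σ rs

-- Top-level lvalues Lval(r) (for vectors: union, here concatenation).
Lval : RVal → List RVal
Lval (const c)  = []
Lval (op o a b) = Lval a ++ Lval b
Lval (acc x rs) = acc x rs ∷ []

LvalVec : ∀ {k} → Vec RVal k → List RVal
LvalVec []       = []
LvalVec (r ∷ rs) = Lval r ++ LvalVec rs

mutual
  vars : RVal → List Var
  vars (const c)  = []
  vars (op o a b) = vars a ++ vars b
  vars (acc x rs) = x ∷ varsVec rs

  varsVec : ∀ {k} → Vec RVal k → List Var
  varsVec []       = []
  varsVec (r ∷ rs) = vars r ++ varsVec rs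

data Cmp : Set where
  eqC neqC ltC leC gtC geC : Cmp

record Atom : Set where
  constructor atom
  field
    lhsA : RVal
    cmp  : Cmp
    rhsA : RVal

record Update : Set where
  constructor _[_]≔_
  field
    uvar : Var
    idx  : Vec RVal (arity uvar)
    rhs  : RVal
open Update public

lhsOf : Update → RVal
lhsOf u = acc (uvar u) (idx u)

record Loop : Set where
  field
    guard    : List Atom            -- conjunction φ
    body     : List Update
    distinct : Unique (map lhsOf body)
open Loop public

-- Semantics of the update substitution `up`.
-- `step T σ` is the state in which up_x(ℓ⃗) denotes x:  evaluating an
-- expression e[up] in σ is evaluating e in (step T σ); hence up^n(e)
-- evaluated in σ is e evaluated in (stepⁿ T n σ).

upSem : List Update → State → State
upSem []       σ x cs = σ x cs
upSem (u ∷ us) σ x cs =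
  if (uvar u ==V x) ∧ does (ListP.≡-dec ℤ._≟_ (toList (evalRs σ (idx u))) (toList cs))
  then evalR σ (rhs u)
  else upSem us σ x cs

step : Loop → State → State
step T = upSem (body T)

stepⁿ : Loop → ℕ → State → State
stepⁿ T zero    σ = σ
stepⁿ T (suc n) σ = step T (stepⁿ T n σ)

data _<lex_ : List ℤ → List ℤ → Set where
  halt  : ∀ {b bs} → [] <lex (b ∷ bs)
  here  : ∀ {a b as bs} → a ℤ.< b → (a ∷ as) <lex (b ∷ bs)
  there : ∀ {a b as bs} → a ≡ b → as <lex bs → (a ∷ as) <lex (b ∷ bs)

_≤lex_ : List ℤ → List ℤ → Set
u ≤lex v = u ≡ v ⊎ u <lex v

idxVal : State → Update → List ℤ
idxVal σ u = toList (evalRs σ (idx u))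

Monotonic : Loop → Set
Monotonic T = ∀ u → u ∈ body T → ∀ σ → idxVal σ u ≤lex idxVal (step T σ) u

data InL (T : Loop) : RVal → Set where
  fromRhs : ∀ {u ℓ} → u ∈ body T → ℓ ∈ Lval (rhs u) → InL T ℓ
  fromIdx : ∀ {x rs ℓ} → InL T (acc x rs) → ℓ ∈ LvalVec rs → InL T ℓ

Trivial : Loop → RVal → Set
Trivial T ℓ = ∀ u → u ∈ body T → uvar u ∉ vars ℓ

-- x[up(r⃗)] ∈ ℓ⃗  (equality of index vectors being validity)
Inductive : Loop → RVal → Set
Inductive T (acc x rs) =
  Σ Update λ u → u ∈ body T × uvar u ≡ x ×
    (∀ σ → idxVal σ u ≡ toList (evalRs (step T σ) rs))
Inductive T _ = Data.Empty.⊥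
  where import Data.Empty

Displacing : Loop → RVal → Set
Displacing T (acc x rs) =
  ∀ u → u ∈ body T → uvar u ≡ x →
    ∀ σ → idxVal σ u <lex toList (evalRs (step T σ) rs)
Displacing T _ = Data.Empty.⊥
  where import Data.Empty

ASolvable : Loop → Set
ASolvable T =
  Monotonic T ×
  (∀ ℓ → InL T ℓ → Trivial T ℓ ⊎ Inductive T ℓ ⊎ Displacing T ℓ) ×
  (∀ u → u ∈ body T →
     (∀ ℓ → ℓ ∈ Lval (rhs u) → Trivial T ℓ ⊎ Inductive T ℓ) ⊎
     (∀ ℓ → ℓ ∈ Lval (rhs u) → Displacing T ℓ))

-- Closed forms.  A (semantic) closed form for an rvalue ℓ is a function
-- cf of the initial state and n with  cf σ n = value of up^n(ℓ) in σ.

ClosedFormFor : Loop → RVal → (State → ℕ → ℤ) → Set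
ClosedFormFor T ℓ f = ∀ σ n → f σ n ≡ evalR (stepⁿ T n σ) ℓ

loopTopLvals : Loop → List RVal
loopTopLvals T = concatMap (λ u → LvalVec (idx u) ++ Lval (rhs u)) (body T)

FixedClosedForms : Loop → (RVal → State → ℕ → ℤ) → Set
FixedClosedForms T cf = ∀ ℓ → ℓ ∈ loopTopLvals T → ClosedFormFor T ℓ (cf ℓ)

-- up(r⃗) − r⃗ is the constant vector d⃗ (a valid equation)
ConstDiff : Loop → (u : Update) → Vec ℤ (arity (uvar u)) → Set
ConstDiff T u d = ∀ σ → zipWith _-_ (evalRs (step T σ) (idx u)) (evalRs σ (idx u)) ≡ d

module _ (T : Loop) (cf : RVal → State → ℕ → ℤ) where

  mutual
    at : State → ℕ → RVal → ℤ
    at σ k (const c)  = c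
    at σ k (op o a b) = ⟦ o ⟧op (at σ k a) (at σ k b)
    at σ k (acc x rs) = cf (acc x rs) σ k

    atVec : ∀ {j} → State → ℕ → Vec RVal j → Vec ℤ j
    atVec σ k []       = []
    atVec σ k (r ∷ rs) = at σ k r ∷ atVec σ k rs

  -- written_{r⃗}(m, c⃗)  ⟺  r⃗^{(m-1)} = c⃗       (m ≥ 1)
  written : State → Update → ℕ → List ℤ → Bool
  written σ u m c = does (ListP.≡-dec ℤ._≟_ (toList (atVec σ (m ℕ.∸ 1) (idx u))) c)

  range : ℕ → ℕ → List ℕ
  range m n = map (m ℕ.+_) (upTo (suc n ℕ.∸ m))

  notwritten : State → Var → ℕ → ℕ → List ℤ → Bool
  notwritten σ x m n c =
    and (map (λ u → not (uvar u ==V x) ∨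
                    and (map (λ m' → not (written σ u m' c)) (range m n)))
             (body T))

  lastWrite : State → Update → ℕ → ℕ → List ℤ → Bool
  lastWrite σ u m n c = written σ u m c ∧ notwritten σ (uvar u) (suc m) n c

  firstNZ : ∀ {k} → Vec ℤ k → Maybe (Fin k)
  firstNZ []       = nothing
  firstNZ (+ zero ∷ ds) with firstNZ ds
  ... | just i  = just (suc i)
  ... | nothing = nothing
  firstNZ (+ suc _ ∷ ds)  = just zero
  firstNZ (-[1+ _ ] ∷ ds) = just zero

  eInst : State → ℕ → (u : Update) → Vec ℤ (arity (uvar u)) →
          Vec ℤ (arity (uvar u)) → ℤ
  eInst σ n u d c with firstNZ d
  ... | just i  = ((Vec.lookup c i - evalR σ (Vec.lookup (idx u) i)) ÷ Vec.lookup d i) + + 1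
  ... | nothing = + n

  -- The candidate closed form x^{(n)}, applied to c⃗ (λc⃗. if … else x[c⃗]),
  -- the if-chain running over the updates x[r⃗₁],…,x[r⃗_k] of ℓ⃗ whose
  -- array variable is x, in their order in ℓ⃗.
  -- d u is the constant vector up(r⃗) − r⃗ of the update u.
  closedFormX : (d : (u : Update) → Vec ℤ (arity (uvar u))) →
                (x : Var) → State → ℕ → Vec ℤ (arity x) → ℤ
  closedFormX d x σ n c = go (body T)
    where
    go : List Update → ℤ
    go [] = σ x c
    go (u ∷ us) with uvar u ≟V x
    ... | no _   = go us
    ... | yes eq =
      let c' = subst (λ v → Vec ℤ (arity v)) (sym eq) c
          m  = eInst σ n u (d u) c'
      in if does (+ 1 ℤ.≤? m) ∧ does (m ℤ.≤? + n) ∧ lastWrite σ u ∣ m ∣ n (toList c)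
         then at σ ∣ m - + 1 ∣ (rhs u)
         else go us

{-# OPTIONS --safe #-}

-- Let σₖ be the state after k iterations. With the fixed closed forms, r^(k) evaluates to r in σₖ,
-- so written_r(k + 1, c) says that the update x[r] assigns the cell x[c] in iteration k + 1, and the
-- guard of its branch says that it made the last assignment to x[c] among the first n iterations,
-- in iteration e_{x[r]}. As r advances by the constant d per iteration, e_{x[r]} is the only
-- iteration in which x[r] can assign x[c] (for d = 0 the index never moves and e_{x[r]} = n).
-- Induction on n: if some update of x assigns x[c] in iteration n + 1, exactly the branches of those
-- updates fire, and both the if-chain and up pick the first of them; otherwise every branch is unchanged from n, and so is the cell.

module Submission where

open import Defs
open import Data.Nat using (ℕ)
open import Data.Integer using (ℤ)
open import Data.Vec using (Vec)
open import Data.List.Membership.Propositional using (_∈_)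
open import Relation.Binary.PropositionalEquality using (_≡_)

open import Data.Bool using (Bool; true; false; not; _∧_; _∨_; if_then_else_; T)
open import Data.Bool.ListAction using (all)
open import Data.Bool.Properties using (T-∧)
open import Data.Empty using (⊥-elim)
open import Data.Fin using (zero; suc)
open import Data.Integer as ℤ using (+_; -[1+_]; 0ℤ; _+_; _-_; _*_; ∣_∣; NonZero; +≤+)
open import Data.Integer.DivMod using (_/_; _%_; a≡a%n+[a/n]*n; n%d<d)
import Data.Integer.Properties as ℤP
open import Data.Integer.Tactic.RingSolver using (solve-∀)
open import Data.List using (List; _∷_; _++_)
import Data.List.Properties as List
open import Data.List.Membership.Propositional using (find; lose)
open import Data.List.Membership.Propositional.Properties
  using (∈-map⁺; ∈-map⁻; ∈-upTo⁺; ∈-upTo⁻; ∈-concat⁺′)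
open import Data.List.Relation.Binary.Subset.Propositional using (_⊆_)
open import Data.List.Relation.Binary.Subset.Propositional.Properties
  using (⊆-trans; xs⊆xs++ys; xs⊆ys++xs)
open import Data.List.Relation.Unary.All as All using (All; []; _∷_)
open import Data.List.Relation.Unary.All.Properties using (all⁺; all⁻; ¬Any⇒All¬)
open import Data.List.Relation.Unary.Any as Any using (Any; here; any?)
open import Data.Maybe using (just; nothing)
import Data.Nat as ℕ
open import Data.Nat using (zero; suc; s≤s)
import Data.Nat.Properties as ℕP
open import Data.Product using (_×_; _,_; proj₁; proj₂; ∃-syntax)
open import Data.Product.Function.NonDependent.Propositional using (_×-⇔_)
open import Data.Vec using ([]; _∷_; lookup; replicate; toList; zipWith)
import Data.Vec.Properties as Vec
open import Data.Vec.Relation.Binary.Equality.Cast using (cast-is-id)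
open import Function using (_∘_; id; _⇔_; mk⇔; Equivalence)
open import Function.Construct.Composition using (_⇔-∘_)
open import Relation.Binary.Definitions using (DecidableEquality)
open import Relation.Nullary using (Dec; yes; no; ¬_; does; contradiction)
open import Relation.Nullary.Decidable using (_×-dec_)
open import Relation.Binary.PropositionalEquality
  using (_≢_; refl; sym; trans; cong; cong₂; subst; module ≡-Reasoning)

open Equivalence using (to; from)

i*j/j≡i : ∀ i j .{{_ : NonZero j}} → (i * j) / j ≡ i
i*j/j≡i i j = sym (ℤP.i-j≡0⇒i≡j i q (ℤP.∣i∣≡0⇒i≡0 (ℕP.n<1⇒n≡0 ∣i-q∣<1)))
  where
  q = (i * j) / j
  r = (i * j) % j

  cancel : ∀ r q j → r ≡ (r + q * j) - q * j
  cancel = solve-∀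

  factor : ∀ i q j → i * j - q * j ≡ (i - q) * j
  factor = solve-∀

  r≡[i-q]*j : + r ≡ (i - q) * j
  r≡[i-q]*j = begin
    + r                   ≡⟨ cancel (+ r) q j ⟩
    (+ r + q * j) - q * j ≡⟨ cong (_- q * j) (a≡a%n+[a/n]*n (i * j) j) ⟨
    i * j - q * j         ≡⟨ factor i q j ⟩
    (i - q) * j           ∎
    where open ≡-Reasoning

  ∣i-q∣<1 : ∣ i - q ∣ ℕ.< 1
  ∣i-q∣<1 = ℕP.*-cancelʳ-< ∣ j ∣ ∣ i - q ∣ 1 (begin-strict
    ∣ i - q ∣ ℕ.* ∣ j ∣ ≡⟨ ℤP.abs-* (i - q) j ⟨
    ∣ (i - q) * j ∣     ≡⟨ cong ∣_∣ r≡[i-q]*j ⟨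
    r                   <⟨ n%d<d (i * j) j ⟩
    ∣ j ∣               ≡⟨ ℕP.*-identityˡ ∣ j ∣ ⟨
    1 ℕ.* ∣ j ∣         ∎)
    where open ℕP.≤-Reasoning

i*j÷j≡i : ∀ i j → j ≢ 0ℤ → (i * j) ÷ j ≡ i
i*j÷j≡i i (+ zero)     j≢0 = contradiction refl j≢0
i*j÷j≡i i j@(+ suc _)  _   = i*j/j≡i i j
i*j÷j≡i i j@(-[1+ _ ]) _   = i*j/j≡i i j

xs-ys≡0⇒xs≡ys : ∀ {k} (xs ys : Vec ℤ k) → zipWith _-_ xs ys ≡ replicate k 0ℤ → xs ≡ ys
xs-ys≡0⇒xs≡ys []       []       _  = refl
xs-ys≡0⇒xs≡ys (x ∷ xs) (y ∷ ys) eq =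
  cong₂ _∷_ (ℤP.i-j≡0⇒i≡j x y (Vec.∷-injectiveˡ eq)) (xs-ys≡0⇒xs≡ys xs ys (Vec.∷-injectiveʳ eq))

lookup-evalRs : ∀ {k} τ (rs : Vec RVal k) i → lookup (evalRs τ rs) i ≡ evalR τ (lookup rs i)
lookup-evalRs τ (r ∷ rs) zero    = refl
lookup-evalRs τ (r ∷ rs) (suc i) = lookup-evalRs τ rs i

_≟ₗ_ : DecidableEquality (List ℤ)
_≟ₗ_ = List.≡-dec ℤ._≟_

T-does⇔ : ∀ {P : Set} (P? : Dec P) → T (does P?) ⇔ P
T-does⇔ (yes p) = mk⇔ (λ _ → p) (λ _ → _)
T-does⇔ (no ¬p) = mk⇔ (λ ()) ¬p

T-not⇔¬T : ∀ {b} → T (not b) ⇔ (¬ T b)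
T-not⇔¬T {true}  = mk⇔ (λ ()) (λ ¬t → ¬t _)
T-not⇔¬T {false} = mk⇔ (λ _ ()) (λ _ → _)

T-¬does-∨⇔ : ∀ {P : Set} (P? : Dec P) {b} → T (not (does P?) ∨ b) ⇔ (P → T b)
T-¬does-∨⇔ (yes p) = mk⇔ (λ t _ → t) (λ f → f p)
T-¬does-∨⇔ (no ¬p) = mk⇔ (λ _ p → contradiction p ¬p) (λ _ → _)

T-all⇔ : ∀ {A : Set} (p : A → Bool) xs → T (all p xs) ⇔ (∀ {x} → x ∈ xs → T (p x))
T-all⇔ p xs = mk⇔ (All.lookup ∘ all⁺ p xs) (all⁻ p ∘ All.tabulate)

T-1≤i≤n∧⇔ : ∀ i n {p : ℕ → Bool} {Q : ℕ → Set} → (∀ {k} → T (p (suc k)) ⇔ Q k) →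
            T (does (+ 1 ℤ.≤? i) ∧ does (i ℤ.≤? + n) ∧ p ∣ i ∣) ⇔
            (∃[ k ] i ≡ + suc k × k ℕ.< n × Q k)
T-1≤i≤n∧⇔ (+ zero)  n _ = mk⇔ (λ ()) (λ { (_ , () , _) })
T-1≤i≤n∧⇔ -[1+ _ ]  n _ = mk⇔ (λ ()) (λ { (_ , () , _) })
T-1≤i≤n∧⇔ (+ suc k) n {p} {Q} p⇔Q = mk⇔ into onto
  where
  into : T (does (+ suc k ℤ.≤? + n) ∧ p (suc k)) → ∃[ k′ ] + suc k ≡ + suc k′ × k′ ℕ.< n × Q k′
  into t with k<n , pk ← to T-∧ t =
    k , refl , ℤP.drop‿+≤+ (to (T-does⇔ (+ suc k ℤ.≤? + n)) k<n) , to p⇔Q pk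

  onto : ∃[ k′ ] + suc k ≡ + suc k′ × k′ ℕ.< n × Q k′ → T (does (+ suc k ℤ.≤? + n) ∧ p (suc k))
  onto (_ , refl , k<n , qk) = from T-∧ (from (T-does⇔ (+ suc k ℤ.≤? + n)) (+≤+ k<n) , from p⇔Q qk)

if-T : ∀ {A : Set} {b} {x y : A} → T b → (if b then x else y) ≡ x
if-T {b = true} _ = refl

if-¬T : ∀ {A : Set} {b} {x y : A} → ¬ T b → (if b then x else y) ≡ y
if-¬T {b = true}  ¬t = contradiction _ ¬t
if-¬T {b = false} _  = refl

if-congᵀ : ∀ {A : Set} {b c} {x y z : A} → (T b ⇔ T c) → x ≡ y →
           (if b then x else z) ≡ (if c then y else z)
if-congᵀ {b = true}  {true}  _   x≡y = x≡y
if-congᵀ {b = true}  {false} b⇔c _   = ⊥-elim (to b⇔c _)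
if-congᵀ {b = false} {true}  b⇔c _   = ⊥-elim (from b⇔c _)
if-congᵀ {b = false} {false} _   _   = refl

Assigns : State → (x : Var) → Vec ℤ (arity x) → Update → Set
Assigns τ x c u = uvar u ≡ x × toList (evalRs τ (idx u)) ≡ toList c

upSem-miss : ∀ {u} us τ {x} {c : Vec ℤ (arity x)} → ¬ Assigns τ x c u →
             upSem (u ∷ us) τ x c ≡ upSem us τ x c
upSem-miss {u} us τ {x} ¬a = if-¬T λ t →
  let u≡x , w = to T-∧ t in ¬a (to (T-does⇔ (uvar u ≟V x)) u≡x , to (T-does⇔ (_ ≟ₗ _)) w)

upSem-none : ∀ {us} τ {x} {c : Vec ℤ (arity x)} → All (¬_ ∘ Assigns τ x c) us → upSem us τ x c ≡ τ x c
upSem-none          τ []         = refl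
upSem-none {u ∷ us} τ (¬a ∷ ¬as) = trans (upSem-miss {u} us τ ¬a) (upSem-none τ ¬as)

-- closedFormX runs a where-bound function over body 𝒯, which Agda does not export;
-- abstracting body 𝒯 lets unification name that function scan.
mutual
  scan : (𝒯 : Loop) (cf : RVal → State → ℕ → ℤ) (d : (u : Update) → Vec ℤ (arity (uvar u)))
         (x : Var) (σ : State) (n : ℕ) (c : Vec ℤ (arity x)) → List Update → ℤ
  scan = _

  closedFormX≡scan : ∀ 𝒯 cf d x σ n c → closedFormX 𝒯 cf d x σ n c ≡ scan 𝒯 cf d x σ n c (body 𝒯)
  closedFormX≡scan 𝒯 cf d x σ n c with body 𝒯
  ... | updates = refl

module _ (𝒯 : Loop) (cf : RVal → State → ℕ → ℤ) where

  ∈-range⁺ : ∀ {a b m} → a ℕ.≤ m → m ℕ.≤ b → m ∈ range 𝒯 cf a b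
  ∈-range⁺ {a} {b} a≤m m≤b = subst (_∈ range 𝒯 cf a b) (ℕP.m+[n∸m]≡n a≤m)
    (∈-map⁺ (a ℕ.+_) (∈-upTo⁺ (ℕP.∸-monoˡ-< (s≤s m≤b) a≤m)))

  ∈-range⁻ : ∀ {a b m} → m ∈ range 𝒯 cf a b → a ℕ.≤ m × m ℕ.≤ b
  ∈-range⁻ {a} {b} m∈ with j , j∈ , refl ← ∈-map⁻ (a ℕ.+_) m∈ =
    ℕP.m≤m+n a j , ℕP.m<1+n⇒m≤n a+j<1+b
    where
    j<1+b∸a : j ℕ.< suc b ℕ.∸ a
    j<1+b∸a = ∈-upTo⁻ j∈

    a≤1+b : a ℕ.≤ suc b
    a≤1+b = ℕP.<⇒≤ (ℕP.m∸n≢0⇒n<m (λ eq → ℕP.n≮0 (subst (j ℕ.<_) eq j<1+b∸a)))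

    a+j<1+b : a ℕ.+ j ℕ.< suc b
    a+j<1+b = subst (a ℕ.+ j ℕ.<_) (ℕP.m+[n∸m]≡n a≤1+b) (ℕP.+-monoʳ-< a j<1+b∸a)

  firstNZ≡nothing⇒≡0 : ∀ {k} (ds : Vec ℤ k) → firstNZ 𝒯 cf ds ≡ nothing → ds ≡ replicate k 0ℤ
  firstNZ≡nothing⇒≡0 []              _  = refl
  firstNZ≡nothing⇒≡0 (+ zero ∷ ds)   eq with firstNZ 𝒯 cf ds in eq′
  ... | nothing = cong (0ℤ ∷_) (firstNZ≡nothing⇒≡0 ds eq′)
  firstNZ≡nothing⇒≡0 (+ zero ∷ ds)   () | just _
  firstNZ≡nothing⇒≡0 (+ suc _ ∷ ds)  ()
  firstNZ≡nothing⇒≡0 (-[1+ _ ] ∷ ds) ()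

  firstNZ≡just⇒≢0 : ∀ {k} (ds : Vec ℤ k) {i} → firstNZ 𝒯 cf ds ≡ just i → lookup ds i ≢ 0ℤ
  firstNZ≡just⇒≢0 (+ zero ∷ ds)   eq with firstNZ 𝒯 cf ds in eq′
  firstNZ≡just⇒≢0 (+ zero ∷ ds)   refl | just _ = firstNZ≡just⇒≢0 ds eq′
  firstNZ≡just⇒≢0 (+ zero ∷ ds)   ()   | nothing
  firstNZ≡just⇒≢0 (+ suc _ ∷ ds)  refl = λ ()
  firstNZ≡just⇒≢0 (-[1+ _ ] ∷ ds) refl = λ ()

  eInst-nothing : ∀ σ n u ds c → firstNZ 𝒯 cf ds ≡ nothing → eInst 𝒯 cf σ n u ds c ≡ + n
  eInst-nothing σ n u ds c eq rewrite eq = refl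

  eInst-just : ∀ σ n u ds c {i} → firstNZ 𝒯 cf ds ≡ just i →
               eInst 𝒯 cf σ n u ds c ≡ ((lookup c i - evalR σ (lookup (idx u) i)) ÷ lookup ds i) + + 1
  eInst-just σ n u ds c eq rewrite eq = refl

  module _ (fixed : FixedClosedForms 𝒯 cf) (σ : State) where

    iterate : ℕ → State
    iterate k = stepⁿ 𝒯 k σ

    index : (u : Update) → ℕ → Vec ℤ (arity (uvar u))
    index u k = evalRs (iterate k) (idx u)

    at≡evalR : ∀ k e → Lval e ⊆ loopTopLvals 𝒯 → at 𝒯 cf σ k e ≡ evalR (iterate k) e
    at≡evalR k (const _)    _   = refl
    at≡evalR k (op o a b)   sub = cong₂ ⟦ o ⟧op (at≡evalR k a (⊆-trans (xs⊆xs++ys _ _) sub))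
                                                 (at≡evalR k b (⊆-trans (xs⊆ys++xs _ _) sub))
    at≡evalR k ℓ@(acc _ _) sub = fixed ℓ (sub (here refl)) σ k

    atVec≡evalRs : ∀ {j} k (es : Vec RVal j) → LvalVec es ⊆ loopTopLvals 𝒯 →
                   atVec 𝒯 cf σ k es ≡ evalRs (iterate k) es
    atVec≡evalRs k []       _   = refl
    atVec≡evalRs k (e ∷ es) sub = cong₂ _∷_ (at≡evalR k e (⊆-trans (xs⊆xs++ys _ _) sub))
                                            (atVec≡evalRs k es (⊆-trans (xs⊆ys++xs _ _) sub))

    update-lvals⊆ : ∀ {u} → u ∈ body 𝒯 → LvalVec (idx u) ++ Lval (rhs u) ⊆ loopTopLvals 𝒯
    update-lvals⊆ u∈ ℓ∈ = ∈-concat⁺′ ℓ∈ (∈-map⁺ _ u∈)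

    atVec-idx : ∀ {u} → u ∈ body 𝒯 → ∀ k → atVec 𝒯 cf σ k (idx u) ≡ index u k
    atVec-idx {u} u∈ k = atVec≡evalRs k (idx u) (⊆-trans (xs⊆xs++ys _ _) (update-lvals⊆ u∈))

    at-rhs : ∀ {u} → u ∈ body 𝒯 → ∀ k → at 𝒯 cf σ k (rhs u) ≡ evalR (iterate k) (rhs u)
    at-rhs {u} u∈ k = at≡evalR k (rhs u) (⊆-trans (xs⊆ys++xs _ (LvalVec (idx u))) (update-lvals⊆ u∈))

    -- Iterations are counted from 0 here: Writes u k c is the paper's written_r(k + 1, c).
    Writes : Update → ℕ → List ℤ → Set
    Writes u k c = toList (index u k) ≡ c

    NoWriteIn : Var → ℕ → ℕ → List ℤ → Set
    NoWriteIn y a b c = ∀ {u} → u ∈ body 𝒯 → uvar u ≡ y → ∀ {k} → a ℕ.≤ k → k ℕ.< b → ¬ Writes u k c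

    LastWrite : ℕ → Update → ℕ → List ℤ → Set
    LastWrite n u k c = k ℕ.< n × Writes u k c × NoWriteIn (uvar u) (suc k) n c

    written⇔ : ∀ {u k c} → u ∈ body 𝒯 → T (written 𝒯 cf σ u (suc k) c) ⇔ Writes u k c
    written⇔ {u} {k} {c} u∈ = mk⇔
      (λ t → trans (cong toList (sym (atVec-idx u∈ k))) (to (T-does⇔ (_ ≟ₗ c)) t))
      (λ w → from (T-does⇔ (_ ≟ₗ c)) (trans (cong toList (atVec-idx u∈ k)) w))

    notwritten⇔ : ∀ {y a b c} → T (notwritten 𝒯 cf σ y (suc a) b c) ⇔ NoWriteIn y a b c
    notwritten⇔ {y} {a} {b} {c} = mk⇔ sound complete
      where
      sound : T (notwritten 𝒯 cf σ y (suc a) b c) → NoWriteIn y a b c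
      sound t {u} u∈ u≡y {k} a≤k k<b w = to T-not⇔¬T unwritten (from (written⇔ u∈) w)
        where
        unwritten : T (not (written 𝒯 cf σ u (suc k) c))
        unwritten = to (T-all⇔ _ _) (to (T-¬does-∨⇔ (uvar u ≟V y)) (to (T-all⇔ _ _) t u∈) u≡y)
                       (∈-range⁺ (s≤s a≤k) k<b)

      complete : NoWriteIn y a b c → T (notwritten 𝒯 cf σ y (suc a) b c)
      complete none = from (T-all⇔ _ _) λ {u} u∈ → from (T-¬does-∨⇔ (uvar u ≟V y)) λ u≡y →
        from (T-all⇔ _ _) λ {m} m∈ → from T-not⇔¬T (unwritten u∈ u≡y m (∈-range⁻ m∈))
        where
        unwritten : ∀ {u} → u ∈ body 𝒯 → uvar u ≡ y → ∀ m → suc a ℕ.≤ m × m ℕ.≤ b →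
                    ¬ T (written 𝒯 cf σ u m c)
        unwritten u∈ u≡y (suc k) (s≤s a≤k , k<b) t = none u∈ u≡y a≤k k<b (to (written⇔ u∈) t)

    lastWrite⇔ : ∀ {u k n c} → u ∈ body 𝒯 →
                 T (lastWrite 𝒯 cf σ u (suc k) n c) ⇔ (Writes u k c × NoWriteIn (uvar u) (suc k) n c)
    lastWrite⇔ u∈ = (written⇔ u∈ ×-⇔ notwritten⇔) ⇔-∘ T-∧

    LastWrite-suc⇔ : ∀ {n u k} {c : Vec ℤ (arity (uvar u))} → u ∈ body 𝒯 →
                     ¬ Any (Assigns (iterate n) (uvar u) c) (body 𝒯) →
                     LastWrite (suc n) u k (toList c) ⇔ LastWrite n u k (toList c)
    LastWrite-suc⇔ {n} {u} {k} {c} u∈ silent = mk⇔ shrink extend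
      where
      shrink : LastWrite (suc n) u k (toList c) → LastWrite n u k (toList c)
      shrink (k<1+n , w , later) with k ℕ.≟ n
      ... | yes refl = contradiction (lose u∈ (refl , w)) silent
      ... | no k≢n   = ℕP.≤∧≢⇒< (ℕP.m<1+n⇒m≤n k<1+n) k≢n , w ,
                       λ u′∈ eq k<k′ k′<n → later u′∈ eq k<k′ (ℕP.m<n⇒m<1+n k′<n)

      extend : LastWrite n u k (toList c) → LastWrite (suc n) u k (toList c)
      extend (k<n , w , later) = ℕP.m<n⇒m<1+n k<n , w , later′
        where
        later′ : NoWriteIn (uvar u) (suc k) (suc n) (toList c)
        later′ {u′} u′∈ eq {k′} k<k′ k′<1+n w′ with k′ ℕ.≟ n
        ... | yes refl = silent (lose u′∈ (eq , w′))
        ... | no k′≢n  = later u′∈ eq k<k′ (ℕP.≤∧≢⇒< (ℕP.m<1+n⇒m≤n k′<1+n) k′≢n) w′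

    index-step : ∀ {u ds} → ConstDiff 𝒯 u ds → ∀ k i →
                 lookup (index u (suc k)) i - lookup (index u k) i ≡ lookup ds i
    index-step {u} Δ k i = trans (sym (Vec.lookup-zipWith _-_ i (index u (suc k)) (index u k)))
                                 (cong (λ v → lookup v i) (Δ (iterate k)))

    index-displacement : ∀ {u ds} → ConstDiff 𝒯 u ds → ∀ k i →
                         lookup (index u k) i - lookup (index u 0) i ≡ + k * lookup ds i
    index-displacement {u} Δ zero    i = ℤP.+-inverseʳ (lookup (index u 0) i)
    index-displacement {u} {ds} Δ (suc k) i = begin
      a (suc k) - a 0
        ≡⟨ ℤP.+-minus-telescope (a (suc k)) (a k) (a 0) ⟨
      (a (suc k) - a k) + (a k - a 0)
        ≡⟨ cong₂ _+_ (index-step {u} Δ k i) (index-displacement {u} Δ k i) ⟩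
      lookup ds i + + k * lookup ds i
        ≡⟨ ℤP.suc-* (+ k) (lookup ds i) ⟨
      + suc k * lookup ds i ∎
      where
      open ≡-Reasoning
      a : ℕ → ℤ
      a k = lookup (index u k) i

    index-stationary : ∀ {u ds} → ConstDiff 𝒯 u ds → ds ≡ replicate (arity (uvar u)) 0ℤ →
                       ∀ k → index u k ≡ index u 0
    index-stationary     Δ ds≡0 zero    = refl
    index-stationary {u} Δ ds≡0 (suc k) =
      trans (xs-ys≡0⇒xs≡ys _ _ (trans (Δ (iterate k)) ds≡0)) (index-stationary {u} Δ ds≡0 k)

    module _ (d : (u : Update) → Vec ℤ (arity (uvar u))) where

      e : ℕ → (u : Update) → Vec ℤ (arity (uvar u)) → ℤ
      e n u c = eInst 𝒯 cf σ n u (d u) c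

      fires : ℕ → (u : Update) → Vec ℤ (arity (uvar u)) → Bool
      fires n u c =
        does (+ 1 ℤ.≤? e n u c) ∧ does (e n u c ℤ.≤? + n) ∧ lastWrite 𝒯 cf σ u ∣ e n u c ∣ n (toList c)

      value : ℤ → Update → ℤ
      value m u = at 𝒯 cf σ ∣ m - + 1 ∣ (rhs u)

      branch : ℕ → (u : Update) → Vec ℤ (arity (uvar u)) → ℤ → ℤ
      branch n u c r = if fires n u c then value (e n u c) u else r

      fires⇔ : ∀ {n u} {c : Vec ℤ (arity (uvar u))} → u ∈ body 𝒯 →
               T (fires n u c) ⇔ (∃[ k ] e n u c ≡ + suc k × LastWrite n u k (toList c))
      fires⇔ {n} {u} {c} u∈ =
        T-1≤i≤n∧⇔ (e n u c) n {λ m → lastWrite 𝒯 cf σ u m n (toList c)} (lastWrite⇔ u∈)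

      data Instantiation (u : Update) : Set where
        stationary : (∀ k → index u k ≡ index u 0) → (∀ n c → e n u c ≡ + n) → Instantiation u
        moving     : (∀ n n′ c → e n u c ≡ e n′ u c) →
                     (∀ n k c → Writes u k (toList c) → e n u c ≡ + suc k) → Instantiation u

      instantiation : ∀ u → ConstDiff 𝒯 u (d u) → Instantiation u
      instantiation u Δ with firstNZ 𝒯 cf (d u) in first
      ... | nothing = stationary (index-stationary {u} Δ (firstNZ≡nothing⇒≡0 (d u) first))
                                 (λ n c → eInst-nothing σ n u (d u) c first)
      ... | just i  = moving (λ n n′ c → trans (e≡ n c) (sym (e≡ n′ c))) writes⇒e≡
        where
        δ = lookup (d u) i

        e≡ : ∀ n c → e n u c ≡ ((lookup c i - evalR σ (lookup (idx u) i)) ÷ δ) + + 1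
        e≡ n c = eInst-just σ n u (d u) c first

        writes⇒e≡ : ∀ n k c → Writes u k (toList c) → e n u c ≡ + suc k
        writes⇒e≡ n k c w = begin
          e n u c                                               ≡⟨ e≡ n c ⟩
          ((lookup c i - evalR σ (lookup (idx u) i)) ÷ δ) + + 1 ≡⟨ cong (λ j → (j ÷ δ) + + 1) shift ⟩
          ((+ k * δ) ÷ δ) + + 1                                 ≡⟨ cong (_+ + 1) (i*j÷j≡i (+ k) δ δ≢0) ⟩
          + k + + 1                                             ≡⟨ cong +_ (ℕP.+-comm k 1) ⟩
          + suc k                                               ∎
          where
          open ≡-Reasoning
          δ≢0 : δ ≢ 0ℤ
          δ≢0 = firstNZ≡just⇒≢0 (d u) first

          index≡c : index u k ≡ c
          index≡c = trans (sym (cast-is-id refl (index u k))) (Vec.toList-injective refl (index u k) c w)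

          shift : lookup c i - evalR σ (lookup (idx u) i) ≡ + k * δ
          shift = begin
            lookup c i - evalR σ (lookup (idx u) i)
              ≡⟨ cong₂ (λ v j → lookup v i - j) index≡c (lookup-evalRs σ (idx u) i) ⟨
            lookup (index u k) i - lookup (index u 0) i
              ≡⟨ index-displacement {u} Δ k i ⟩
            + k * δ ∎

      branch-zero : ∀ {u} {c : Vec ℤ (arity (uvar u))} {r} → u ∈ body 𝒯 → branch 0 u c r ≡ r
      branch-zero {u} {c} u∈ = if-¬T (no-write ∘ to (fires⇔ u∈))
        where
        no-write : ¬ (∃[ k ] e 0 u c ≡ + suc k × LastWrite 0 u k (toList c))
        no-write (_ , _ , () , _)

      branch-writes : ∀ {n u} {c : Vec ℤ (arity (uvar u))} {r} → u ∈ body 𝒯 → ConstDiff 𝒯 u (d u) →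
                      Writes u n (toList c) → branch (suc n) u c r ≡ evalR (iterate n) (rhs u)
      branch-writes {n} {u} {c} u∈ Δ w = begin
        branch (suc n) u c _      ≡⟨ if-T (from (fires⇔ u∈) (n , e≡1+n , ℕP.≤-refl , w , none-later)) ⟩
        value (e (suc n) u c) u   ≡⟨ cong (λ m → value m u) e≡1+n ⟩
        at 𝒯 cf σ n (rhs u)       ≡⟨ at-rhs u∈ n ⟩
        evalR (iterate n) (rhs u) ∎
        where
        open ≡-Reasoning
        e≡1+n : e (suc n) u c ≡ + suc n
        e≡1+n with instantiation u Δ
        ... | stationary _ e≡n    = e≡n (suc n) c
        ... | moving _ writes⇒e≡ = writes⇒e≡ (suc n) n c w

        none-later : NoWriteIn (uvar u) (suc n) (suc n) (toList c)
        none-later _ _ n<k k<1+n _ = ℕP.<⇒≱ k<1+n n<k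

      branch-overwritten : ∀ {n u} {c : Vec ℤ (arity (uvar u))} {r} → u ∈ body 𝒯 →
                           Any (Assigns (iterate n) (uvar u) c) (body 𝒯) → ¬ Writes u n (toList c) →
                           branch (suc n) u c r ≡ r
      branch-overwritten {n} {u} {c} u∈ written-at-n ¬w = if-¬T (not-last ∘ to (fires⇔ u∈))
        where
        not-last : ¬ (∃[ k ] e (suc n) u c ≡ + suc k × LastWrite (suc n) u k (toList c))
        not-last (k , _ , k<1+n , wk , later) with k ℕ.≟ n | find written-at-n
        ... | yes refl | _                 = ¬w wk
        ... | no k≢n   | _ , u′∈ , eq , w′ =
          later u′∈ eq (ℕP.≤∧≢⇒< (ℕP.m<1+n⇒m≤n k<1+n) k≢n) (ℕP.n<1+n n) w′

      branch-unwritten : ∀ {n u} {c : Vec ℤ (arity (uvar u))} {r} → u ∈ body 𝒯 → ConstDiff 𝒯 u (d u) →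
                         ¬ Any (Assigns (iterate n) (uvar u) c) (body 𝒯) →
                         branch (suc n) u c r ≡ branch n u c r
      branch-unwritten {n} {u} {c} u∈ Δ silent with instantiation u Δ
      ... | stationary fixed-index _ = trans (if-¬T never) (sym (if-¬T never))
        where
        never : ∀ {m} → ¬ T (fires m u c)
        never t with k , _ , _ , w , _ ← to (fires⇔ u∈) t =
          silent (lose u∈ (refl , trans (cong toList (trans (fixed-index n) (sym (fixed-index k)))) w))
      ... | moving e-const _ =
        if-congᵀ (mk⇔ (transfer (to lw⇔)) (transfer (from lw⇔)))
                 (cong (λ m → value m u) (e-const (suc n) n c))
        where
        lw⇔ : ∀ {k} → LastWrite (suc n) u k (toList c) ⇔ LastWrite n u k (toList c)
        lw⇔ = LastWrite-suc⇔ u∈ silent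

        transfer : ∀ {m m′} → (∀ {k} → LastWrite m u k (toList c) → LastWrite m′ u k (toList c)) →
                   T (fires m u c) → T (fires m′ u c)
        transfer {m} {m′} lw t with k , e≡ , last ← to (fires⇔ u∈) t =
          from (fires⇔ u∈) (k , trans (e-const m′ m c) e≡ , lw last)

      module _ {x : Var} (c : Vec ℤ (arity x))
               (Δ : ∀ u → u ∈ body 𝒯 → uvar u ≡ x → ConstDiff 𝒯 u (d u)) where

        chain : ℕ → List Update → ℤ
        chain n = scan 𝒯 cf d x σ n c

        chain-zero : ∀ {us} → All (_∈ body 𝒯) us → chain 0 us ≡ σ x c
        chain-zero []                 = refl
        chain-zero {u ∷ _} (u∈ ∷ us∈) with uvar u ≟V x
        ... | no _     = chain-zero us∈
        ... | yes refl = trans (branch-zero u∈) (chain-zero us∈)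

        chain-suc-written : ∀ {n us} → Any (Assigns (iterate n) x c) (body 𝒯) → All (_∈ body 𝒯) us →
                            Any (Assigns (iterate n) x c) us →
                            chain (suc n) us ≡ upSem us (iterate n) x c
        chain-suc-written {n} {u ∷ us} written-at-n (u∈ ∷ us∈) hit with uvar u ≟V x
        ... | no u≢x = chain-suc-written written-at-n us∈ (Any.tail (u≢x ∘ proj₁) hit)
        ... | yes refl with toList (index u n) ≟ₗ toList c
        ...   | yes w = branch-writes u∈ (Δ u u∈ refl) w
        ...   | no ¬w = trans (branch-overwritten u∈ written-at-n ¬w)
                              (chain-suc-written written-at-n us∈ (Any.tail (¬w ∘ proj₂) hit))

        chain-suc-unwritten : ∀ {n us} → ¬ Any (Assigns (iterate n) x c) (body 𝒯) → All (_∈ body 𝒯) us →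
                              chain (suc n) us ≡ chain n us
        chain-suc-unwritten              silent []         = refl
        chain-suc-unwritten {n} {u ∷ us} silent (u∈ ∷ us∈) with uvar u ≟V x
        ... | no _     = chain-suc-unwritten silent us∈
        ... | yes refl = trans (branch-unwritten u∈ (Δ u u∈ refl) silent)
                               (cong (branch n u c) (chain-suc-unwritten silent us∈))

        all-updates : All (_∈ body 𝒯) (body 𝒯)
        all-updates = All.tabulate id

        chain-correct : ∀ n → chain n (body 𝒯) ≡ iterate n x c
        chain-correct zero = chain-zero all-updates
        chain-correct (suc n) with any? (λ u → uvar u ≟V x ×-dec toList (index u n) ≟ₗ toList c) (body 𝒯)
        ... | yes written-at-n = chain-suc-written written-at-n all-updates written-at-n
        ... | no silent = begin
          chain (suc n) (body 𝒯)         ≡⟨ chain-suc-unwritten silent all-updates ⟩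
          chain n (body 𝒯)               ≡⟨ chain-correct n ⟩
          iterate n x c                  ≡⟨ upSem-none (iterate n) (¬Any⇒All¬ (body 𝒯) silent) ⟨
          upSem (body 𝒯) (iterate n) x c ∎
          where open ≡-Reasoning

theorem3 : (T : Loop) (x : Var) →
    ASolvable T →
    (cf : RVal → State → ℕ → ℤ) → FixedClosedForms T cf →
    (d : (u : Update) → Vec ℤ (arity (uvar u))) →
    (∀ u → u ∈ body T → uvar u ≡ x → ConstDiff T u (d u)) →
    ∀ (σ : State) (n : ℕ) (c : Vec ℤ (arity x)) →
      closedFormX T cf d x σ n c ≡ stepⁿ T n σ x c
theorem3 𝒯 x _ cf fixed d Δ σ n c =
  -- a-solvability only serves, in the paper, to obtain the closed forms cf that are assumed here
  trans (closedFormX≡scan 𝒯 cf d x σ n c) (chain-correct 𝒯 cf fixed σ d c Δ n)
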